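{- Let $P$ be a Catalan power series with predual basis $(\tilde e_i)_{i\in\mathbb N^2}$ and dual coefficients $(T_i)_{i\in\mathbb N^2}$, and let $\widehat T(z,t)=\sum_{i\in\mathbb N^2}T_i\tilde e_i(z,t)$ (which equals $t$). Then for every positive integer $n$, $\Pi_n(\widehat T,\dots,\widehat T)=t^n$.
   Context: $q$ is a fixed parameter; all series are formal. A Catalan power series is a power series $P(z,t)$ with $P(z,t)=t-z\tilde P(z,t)t^2$ for some power series $\tilde P$. Its predual basis is $\tilde e_i(z,t)=z^{i_1}\prod_{0\le j<i_2}P(q^jz,t)$ for $i=(i_1,i_2)\in\mathbb N^2$ (empty product $=1$), a basis of power series in $(z,t)$; the dual coefficients $(T_i)$ are the unique numbers with $\sum_iT_i\tilde e_i(z,t)=t$. For $n\ge1$, $\Pi_n$ is the $n$-linear map on power series in $(z,t)$ defined on the predual basis by $\Pi_n(\tilde e_{i_1},\dots,\tilde e_{i_n})(z,t)=\prod_{m=1}^n\tilde e_{i_m}(q^{s_m}z,t)$ with $s_m$ the second coordinate of $i_1+\dots+i_{m-1}$ ($s_1=0$), and extended $n$-linearly via expansions in the predual basis. -}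

module Defs where

open import Level using (Level)
open import Data.Nat using (ℕ; zero; suc; _∸_) renaming (_+_ to _+ℕ_; _*_ to _*ℕ_)
open import Data.Nat.Properties using (_≟_)
open import Data.Product using (_×_; _,_; proj₁; proj₂; Σ)
open import Data.Vec using (Vec; []; _∷_; lookup)
open import Data.Fin using (Fin)
import Data.Fin as Fin
open import Relation.Nullary using (yes; no)
open import Algebra.Bundles using (CommutativeRing)

-- Formal power series in two variables (z,t) over a commutative ring R
-- containing the parameter q.  A series f is its coefficient function:
-- f a b = coefficient of z^a t^b.
module Series {c ℓ : Level} (R : CommutativeRing c ℓ) (q : CommutativeRing.Carrier R) where
  open CommutativeRing R

  PS : Set c
  PS = ℕ → ℕ → Carrier

  -- coefficient families indexed by ℕ² (i = (i₁ , i₂) written as two arguments)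
  Coeffs : Set c
  Coeffs = ℕ → ℕ → Carrier

  _≋_ : PS → PS → Set ℓ
  f ≋ g = ∀ a b → f a b ≈ g a b

  pow : Carrier → ℕ → Carrier
  pow x zero = 1#
  pow x (suc n) = x * pow x n

  sumTo : ℕ → (ℕ → Carrier) → Carrier
  sumTo zero f = f 0
  sumTo (suc n) f = sumTo n f + f (suc n)

  mono : ℕ → ℕ → PS
  mono i j a b with a ≟ i | b ≟ j
  ... | yes _ | yes _ = 1#
  ... | _ | _ = 0#

  one : PS
  one = mono 0 0

  tSer : PS
  tSer = mono 0 1

  tPow : ℕ → PS
  tPow n = mono 0 n

  mul : PS → PS → PS
  mul f g a b = sumTo a (λ i → sumTo b (λ j → f i j * g (a ∸ i) (b ∸ j)))

  -- f(q^s z, t)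
  dil : ℕ → PS → PS
  dil s f a b = pow q (s *ℕ a) * f a b

  IsCatalan : PS → Set (c Level.⊔ ℓ)
  IsCatalan P = Σ PS (λ P̃ → P ≋ (λ a b → tSer a b - mul (mono 1 2) P̃ a b))

  module _ (P : PS) where
    prodP : ℕ → PS
    prodP zero = one
    prodP (suc k) = mul (prodP k) (dil k P)

    ẽ : ℕ → ℕ → PS
    ẽ i₁ i₂ = mul (mono i₁ 0) (prodP i₂)

    -- Formal sum  Σ_{i ∈ ℕ²} c_i ẽ_i .  Since ẽ_i = z^{i₁} t^{i₂}·(power series),
    -- only i with i₁ ≤ a, i₂ ≤ b contribute to the coefficient of z^a t^b.
    expand : Coeffs → PS
    expand c a b = sumTo a (λ i₁ → sumTo b (λ i₂ → c i₁ i₂ * ẽ i₁ i₂ a b))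

    IsDualCoeffs : Coeffs → Set ℓ
    IsDualCoeffs T = expand T ≋ tSer

    -- Π_n on predual basis elements: for indices i_1,…,i_n (a vector),
    -- ∏_m ẽ_{i_m}(q^{s_m} z, t) with s_m = Σ_{k<m} second coord of i_k.
    piBasis : {n : ℕ} → ℕ → Vec (ℕ × ℕ) n → PS
    piBasis s [] = one
    piBasis s ((i₁ , i₂) ∷ v) = mul (dil s (ẽ i₁ i₂)) (piBasis (s +ℕ i₂) v)

    sumBox : ℕ → ℕ → (n : ℕ) → (Vec (ℕ × ℕ) n → Carrier) → Carrier
    sumBox a b zero F = F []
    sumBox a b (suc n) F =
      sumTo a (λ i₁ → sumTo b (λ i₂ → sumBox a b n (λ v → F ((i₁ , i₂) ∷ v))))

    prodCoeffs : {n : ℕ} → (Fin n → Coeffs) → Vec (ℕ × ℕ) n → Carrier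
    prodCoeffs {n} c v = go v c
      where
      go : {m : ℕ} → Vec (ℕ × ℕ) m → (Fin m → Coeffs) → Carrier
      go [] c = 1#
      go ((i₁ , i₂) ∷ w) c = c Fin.zero i₁ i₂ * go w (λ k → c (Fin.suc k))

    -- Π_n(f_1,…,f_n) where c m is the predual-basis expansion of f_m:
    -- Σ_{i_1,…,i_n} (∏_m c_m(i_m)) · Π_n(ẽ_{i_1},…,ẽ_{i_n}).
    -- The coefficient of z^a t^b only receives contributions from tuples with
    -- every i_m ≤ (a,b) componentwise (leading term of the basis product is
    -- z^{Σ i_{m,1}} t^{Σ i_{m,2}}), so the formal sum is this finite sum.
    Πn : (n : ℕ) → (Fin n → Coeffs) → PS
    Πn n c a b = sumBox a b n (λ v → prodCoeffs c v * piBasis 0 v a b)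

module Submission where

open import Defs
open import Level using (Level)
open import Data.Nat using (ℕ; _≤_)
open import Algebra.Bundles using (CommutativeRing)

open import Data.Nat using (zero; suc; _<_; _∸_; z≤n; s≤s) renaming (_+_ to _+ℕ_; _*_ to _*ℕ_)
open import Data.Nat.Properties
  using (_≟_; ≤-refl; ≤-<-trans; m≤n⇒m≤1+n; m∸n≤m; ≤∧≢⇒<; ≤-pred; <⇒≢; suc-injective)
open import Data.Nat.Properties as ℕ using ()
open import Data.Product using (_×_; _,_; proj₁; proj₂)
open import Data.Empty using (⊥-elim)
open import Data.Sum using (_⊎_; inj₁; inj₂)
open import Data.Vec using (Vec; []; _∷_)
open import Data.Vec.Relation.Unary.Any using (Any; here; there)
open import Data.Vec.Membership.Propositional using (_∈_; find)
open import Relation.Nullary using (Dec; yes; no)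
open import Relation.Binary.PropositionalEquality as PE using (_≡_; _≢_)
import Algebra.Properties.CommutativeSemigroup as CommutativeSemigroupProperties
import Relation.Binary.Reasoning.Setoid as SetoidReasoning

-- Write Πfrom n s for Π_n(T̂,…,T̂) in which the dilations start at
-- q^s instead of q^0, so that Π_n = Πfrom n 0.  We show Πfrom n s = t^n for all
-- n and s by induction on n (the case n = 0 is the empty product 1 = t^0, so the
-- hypothesis 1 ≤ n is not needed).  Peeling off the first index i gives
--   Πfrom (n+1) s = Σ_i T_i · ẽ_i(q^s z,t) · Πfrom n (s + i₂),
-- and the induction hypothesis turns the second factor into t^n independently of
-- i, so the sum collapses to (Σ_i T_i ẽ_i)(q^s z,t) · t^n = t(q^s z,t) · t^n = t^{n+1}.

module Proof {c ℓ : Level} (R : CommutativeRing c ℓ) (q : CommutativeRing.Carrier R) where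
  open CommutativeRing R hiding (zero)
  open Series R q
  open SetoidReasoning setoid
  open CommutativeSemigroupProperties *-commutativeSemigroup using (x∙yz≈y∙xz)
  open CommutativeSemigroupProperties +-commutativeSemigroup using (interchange)

  product-zero : ∀ {x y} → (x ≈ 0# ⊎ y ≈ 0#) → x * y ≈ 0#
  product-zero (inj₁ x≈0) = trans (*-cong x≈0 refl) (zeroˡ _)
  product-zero (inj₂ y≈0) = trans (*-cong refl y≈0) (zeroʳ _)

  -- If x' ≤ x < i + k then either x' lies below i or the cofactor x - x' lies below k;
  -- this is why z^i·z^k divides a product of a multiple of z^i and a multiple of z^k.
  below-split : ∀ {x x'} i k → x' ≤ x → x < i +ℕ k → x' < i ⊎ x ∸ x' < k
  below-split {x' = zero}  (suc i) k x'≤x x<i+k = inj₁ (s≤s z≤n)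
  below-split {x' = zero}  zero    k x'≤x x<i+k = inj₂ x<i+k
  below-split {x} {suc x'} zero    k x'≤x x<i+k = inj₂ (≤-<-trans (m∸n≤m x (suc x')) x<i+k)
  below-split {suc x} {suc x'} (suc i) k (s≤s x'≤x) (s≤s x<i+k) with below-split i k x'≤x x<i+k
  ... | inj₁ x'<i = inj₁ (s≤s x'<i)
  ... | inj₂ lt = inj₂ lt

  sumTo-cong : ∀ a {f g : ℕ → Carrier} → (∀ i → i ≤ a → f i ≈ g i) → sumTo a f ≈ sumTo a g
  sumTo-cong zero    h = h 0 z≤n
  sumTo-cong (suc a) h = +-cong (sumTo-cong a (λ i i≤a → h i (m≤n⇒m≤1+n i≤a))) (h (suc a) ≤-refl)

  sumTo-zero : ∀ a {f : ℕ → Carrier} → (∀ i → i ≤ a → f i ≈ 0#) → sumTo a f ≈ 0#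
  sumTo-zero zero    h = h 0 z≤n
  sumTo-zero (suc a) h =
    trans (+-cong (sumTo-zero a (λ i i≤a → h i (m≤n⇒m≤1+n i≤a))) (h (suc a) ≤-refl)) (+-identityʳ 0#)

  sumTo-+ : ∀ a (f g : ℕ → Carrier) → sumTo a (λ i → f i + g i) ≈ sumTo a f + sumTo a g
  sumTo-+ zero    f g = refl
  sumTo-+ (suc a) f g = trans (+-cong (sumTo-+ a f g) refl) (interchange _ _ _ _)

  sumTo-distribˡ : ∀ a x (f : ℕ → Carrier) → x * sumTo a f ≈ sumTo a (λ i → x * f i)
  sumTo-distribˡ zero    x f = refl
  sumTo-distribˡ (suc a) x f = trans (distribˡ x _ _) (+-cong (sumTo-distribˡ a x f) refl)

  sumTo-distribʳ : ∀ a x (f : ℕ → Carrier) → sumTo a f * x ≈ sumTo a (λ i → f i * x)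
  sumTo-distribʳ a x f =
    trans (*-comm _ x) (trans (sumTo-distribˡ a x f) (sumTo-cong a (λ i _ → *-comm x (f i))))

  sumTo-swap : ∀ a b (f : ℕ → ℕ → Carrier) →
    sumTo a (λ i → sumTo b (f i)) ≈ sumTo b (λ j → sumTo a (λ i → f i j))
  sumTo-swap zero    b f = refl
  sumTo-swap (suc a) b f =
    trans (+-cong (sumTo-swap a b f) refl) (sym (sumTo-+ b (λ j → sumTo a (λ i → f i j)) (f (suc a))))

  sumTo-shrink : ∀ a {a'} (f : ℕ → Carrier) → a' ≤ a → (∀ i → a' < i → i ≤ a → f i ≈ 0#) →
    sumTo a f ≈ sumTo a' f
  sumTo-shrink zero    f z≤n h = refl
  sumTo-shrink (suc a) {a'} f a'≤ h with a' ≟ suc a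
  ... | yes PE.refl = refl
  ... | no a'≢ = begin
    sumTo a f + f (suc a) ≈⟨ +-cong refl (h (suc a) (s≤s a'≤a) ≤-refl) ⟩
    sumTo a f + 0#        ≈⟨ +-identityʳ _ ⟩
    sumTo a f             ≈⟨ sumTo-shrink a f a'≤a (λ i a'<i i≤a → h i a'<i (m≤n⇒m≤1+n i≤a)) ⟩
    sumTo a' f            ∎
    where
    a'≤a : a' ≤ a
    a'≤a = ≤-pred (≤∧≢⇒< a'≤ a'≢)

  sumTo-single : ∀ a {i} (f : ℕ → Carrier) → i ≤ a → (∀ k → k ≤ a → k ≢ i → f k ≈ 0#) →
    sumTo a f ≈ f i
  sumTo-single zero    f z≤n h = refl
  sumTo-single (suc a) {i} f i≤ h with i ≟ suc a
  ... | yes PE.refl =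
    trans (+-cong (sumTo-zero a (λ k k≤a → h k (m≤n⇒m≤1+n k≤a) (<⇒≢ (s≤s k≤a)))) refl) (+-identityˡ _)
  ... | no i≢ =
    trans (+-cong (sumTo-single a f (≤-pred (≤∧≢⇒< i≤ i≢)) (λ k k≤a → h k (m≤n⇒m≤1+n k≤a)))
                  (h (suc a) ≤-refl (λ e → i≢ (PE.sym e))))
          (+-identityʳ _)

  sum2 : ℕ → ℕ → (ℕ → ℕ → Carrier) → Carrier
  sum2 a b F = sumTo a (λ x → sumTo b (F x))

  Outside : ℕ → ℕ → ℕ × ℕ → Set
  Outside a b (x , y) = a < x ⊎ b < y

  sum2-cong : ∀ a b {F G : ℕ → ℕ → Carrier} → (∀ x y → x ≤ a → y ≤ b → F x y ≈ G x y) →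
    sum2 a b F ≈ sum2 a b G
  sum2-cong a b h = sumTo-cong a (λ x x≤a → sumTo-cong b (λ y y≤b → h x y x≤a y≤b))

  sum2-zero : ∀ a b {F : ℕ → ℕ → Carrier} → (∀ x y → x ≤ a → y ≤ b → F x y ≈ 0#) → sum2 a b F ≈ 0#
  sum2-zero a b h = sumTo-zero a (λ x x≤a → sumTo-zero b (λ y y≤b → h x y x≤a y≤b))

  sum2-distribˡ : ∀ a b x (F : ℕ → ℕ → Carrier) → x * sum2 a b F ≈ sum2 a b (λ i j → x * F i j)
  sum2-distribˡ a b x F =
    trans (sumTo-distribˡ a x _) (sumTo-cong a (λ i _ → sumTo-distribˡ b x (F i)))

  sum2-sumTo-swap : ∀ a b d (F : ℕ → ℕ → ℕ → Carrier) →
    sum2 a b (λ x y → sumTo d (F x y)) ≈ sumTo d (λ k → sum2 a b (λ x y → F x y k))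
  sum2-sumTo-swap a b d F = trans (sumTo-cong a (λ x _ → sumTo-swap b d (F x))) (sumTo-swap a d _)

  sum2-shrink : ∀ a b {a' b'} (F : ℕ → ℕ → Carrier) → a' ≤ a → b' ≤ b →
    (∀ x y → Outside a' b' (x , y) → F x y ≈ 0#) → sum2 a b F ≈ sum2 a' b' F
  sum2-shrink a b {a'} {b'} F a'≤a b'≤b h = begin
    sum2 a b F   ≈⟨ sumTo-cong a (λ x _ → sumTo-shrink b (F x) b'≤b (λ y b'<y _ → h x y (inj₂ b'<y))) ⟩
    sum2 a b' F  ≈⟨ sumTo-shrink a _ a'≤a (λ x a'<x _ → sumTo-zero b' (λ y _ → h x y (inj₁ a'<x))) ⟩
    sum2 a' b' F ∎

  sum2-single : ∀ a b {i j} (F : ℕ → ℕ → Carrier) → i ≤ a → j ≤ b →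
    (∀ x y → x ≤ a → y ≤ b → (x ≢ i ⊎ y ≢ j) → F x y ≈ 0#) → sum2 a b F ≈ F i j
  sum2-single a b F i≤a j≤b h = trans
    (sumTo-single a _ i≤a (λ x x≤a x≢i → sumTo-zero b (λ y y≤b → h x y x≤a y≤b (inj₁ x≢i))))
    (sumTo-single b _ j≤b (λ y y≤b y≢j → h _ y i≤a y≤b (inj₂ y≢j)))

  mono-hit : ∀ i j → mono i j i j ≈ 1#
  mono-hit i j with i ≟ i | j ≟ j
  ... | yes _ | yes _  = refl
  ... | no i≢i | _     = ⊥-elim (i≢i PE.refl)
  ... | yes _ | no j≢j = ⊥-elim (j≢j PE.refl)

  mono-miss : ∀ i j x y → (x ≢ i ⊎ y ≢ j) → mono i j x y ≈ 0#
  mono-miss i j x y off with x ≟ i | y ≟ j | off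
  ... | yes x≡i | yes _   | inj₁ x≢i = ⊥-elim (x≢i x≡i)
  ... | yes _   | yes y≡j | inj₂ y≢j = ⊥-elim (y≢j y≡j)
  ... | yes _   | no _    | _        = refl
  ... | no _    | _       | _        = refl

  mono-shift : ∀ i j x y → mono i j x y ≈ mono i (suc j) x (suc y)
  mono-shift i j x y = shift (x ≟ i) (y ≟ j)
    where
    shift : Dec (x ≡ i) → Dec (y ≡ j) → mono i j x y ≈ mono i (suc j) x (suc y)
    shift (yes PE.refl) (yes PE.refl) = trans (mono-hit i j) (sym (mono-hit i (suc j)))
    shift (no x≢i) _ =
      trans (mono-miss i j x y (inj₁ x≢i)) (sym (mono-miss i (suc j) x (suc y) (inj₁ x≢i)))
    shift (yes _) (no y≢j) =
      trans (mono-miss i j x y (inj₂ y≢j))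
            (sym (mono-miss i (suc j) x (suc y) (inj₂ (λ e → y≢j (suc-injective e)))))

  dil-mono₀ : ∀ s j → dil s (mono 0 j) ≋ mono 0 j
  dil-mono₀ s j zero    y rewrite ℕ.*-zeroʳ s = *-identityˡ _
  dil-mono₀ s j (suc x) y =
    trans (product-zero (inj₂ (mono-miss 0 j (suc x) y (inj₁ (λ ())))))
          (sym (mono-miss 0 j (suc x) y (inj₁ (λ ()))))

  mul-cong-box : ∀ {f f' g g' : PS} a b →
    (∀ x y → x ≤ a → y ≤ b → f x y ≈ f' x y) → (∀ x y → x ≤ a → y ≤ b → g x y ≈ g' x y) →
    mul f g a b ≈ mul f' g' a b
  mul-cong-box a b hf hg =
    sum2-cong a b (λ x y x≤a y≤b → *-cong (hf x y x≤a y≤b) (hg (a ∸ x) (b ∸ y) (m∸n≤m a x) (m∸n≤m b y)))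

  mul-scalˡ : ∀ x (f g : PS) a b → mul (λ i j → x * f i j) g a b ≈ x * mul f g a b
  mul-scalˡ x f g a b = trans (sum2-cong a b (λ _ _ _ _ → *-assoc _ _ _)) (sym (sum2-distribˡ a b x _))

  mul-scalʳ : ∀ x (f g : PS) a b → mul f (λ i j → x * g i j) a b ≈ x * mul f g a b
  mul-scalʳ x f g a b = trans (sum2-cong a b (λ _ _ _ _ → x∙yz≈y∙xz _ _ _)) (sym (sum2-distribˡ a b x _))

  mul-sumToˡ : ∀ d (f : ℕ → PS) (g : PS) a b →
    mul (λ x y → sumTo d (λ k → f k x y)) g a b ≈ sumTo d (λ k → mul (f k) g a b)
  mul-sumToˡ d f g a b =
    trans (sum2-cong a b (λ x y _ _ → sumTo-distribʳ d _ _)) (sum2-sumTo-swap a b d _)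

  mul-sumToʳ : ∀ d (f : PS) (g : ℕ → PS) a b →
    mul f (λ x y → sumTo d (λ k → g k x y)) a b ≈ sumTo d (λ k → mul f (g k) a b)
  mul-sumToʳ d f g a b =
    trans (sum2-cong a b (λ x y _ _ → sumTo-distribˡ d _ _)) (sum2-sumTo-swap a b d _)

  mul-sum2ˡ : ∀ a' b' (F : ℕ → ℕ → PS) (g : PS) a b →
    mul (λ x y → sum2 a' b' (λ i j → F i j x y)) g a b ≈ sum2 a' b' (λ i j → mul (F i j) g a b)
  mul-sum2ˡ a' b' F g a b =
    trans (mul-sumToˡ a' _ g a b) (sumTo-cong a' (λ i _ → mul-sumToˡ b' (F i) g a b))

  -- Divisibility: DivBy f i j says that z^i t^j divides f, i.e. f has no
  -- monomial outside the quadrant x ≥ i, y ≥ j.  It is what lets formal sums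
  -- over ℕ² be truncated to finite boxes.
  DivBy : PS → ℕ → ℕ → Set ℓ
  DivBy f i j = ∀ x y → x < i ⊎ y < j → f x y ≈ 0#

  DivBy-00 : ∀ (f : PS) → DivBy f 0 0
  DivBy-00 f x y (inj₁ ())
  DivBy-00 f x y (inj₂ ())

  mul-DivBy : ∀ {f g : PS} {i j k l} → DivBy f i j → DivBy g k l → DivBy (mul f g) (i +ℕ k) (j +ℕ l)
  mul-DivBy {f} {g} {i} {j} {k} {l} hf hg a b out = sum2-zero a b (λ x y x≤a y≤b → term x y x≤a y≤b out)
    where
    term : ∀ x y → x ≤ a → y ≤ b → a < i +ℕ k ⊎ b < j +ℕ l → f x y * g (a ∸ x) (b ∸ y) ≈ 0#
    term x y x≤a y≤b (inj₁ a<i+k) with below-split i k x≤a a<i+k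
    ... | inj₁ x<i   = product-zero (inj₁ (hf x y (inj₁ x<i)))
    ... | inj₂ a-x<k = product-zero (inj₂ (hg _ _ (inj₁ a-x<k)))
    term x y x≤a y≤b (inj₂ b<j+l) with below-split j l y≤b b<j+l
    ... | inj₁ y<j   = product-zero (inj₁ (hf x y (inj₂ y<j)))
    ... | inj₂ b-y<l = product-zero (inj₂ (hg _ _ (inj₂ b-y<l)))

  mul-DivByˡ : ∀ {f : PS} (g : PS) {i j} → DivBy f i j → DivBy (mul f g) i j
  mul-DivByˡ g {i} {j} hf =
    PE.subst₂ (DivBy (mul _ g)) (ℕ.+-identityʳ i) (ℕ.+-identityʳ j) (mul-DivBy hf (DivBy-00 g))

  mul-DivByʳ : ∀ (f : PS) {g : PS} {i j} → DivBy g i j → DivBy (mul f g) i j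
  mul-DivByʳ f hg = mul-DivBy (DivBy-00 f) hg

  dil-DivBy : ∀ s {f : PS} {i j} → DivBy f i j → DivBy (dil s f) i j
  dil-DivBy s hf x y out = product-zero (inj₂ (hf x y out))

  mono-DivBy : ∀ i j → DivBy (mono i j) i j
  mono-DivBy i j x y (inj₁ x<i) = mono-miss i j x y (inj₁ (<⇒≢ x<i))
  mono-DivBy i j x y (inj₂ y<j) = mono-miss i j x y (inj₂ (<⇒≢ y<j))

  mul-mono : ∀ i j (g : PS) a b → i ≤ a → j ≤ b → mul (mono i j) g a b ≈ g (a ∸ i) (b ∸ j)
  mul-mono i j g a b i≤a j≤b = begin
    mul (mono i j) g a b
      ≈⟨ sum2-single a b _ i≤a j≤b (λ x y _ _ off → product-zero (inj₁ (mono-miss i j x y off))) ⟩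
    mono i j i j * g (a ∸ i) (b ∸ j) ≈⟨ trans (*-cong (mono-hit i j) refl) (*-identityˡ _) ⟩
    g (a ∸ i) (b ∸ j)                ∎

  t-mul-tPow : ∀ n → mul tSer (tPow n) ≋ tPow (suc n)
  t-mul-tPow n a zero =
    trans (mul-DivByˡ (tPow n) (mono-DivBy 0 1) a 0 (inj₂ (s≤s z≤n)))
          (sym (mono-miss 0 (suc n) a 0 (inj₂ (λ ()))))
  t-mul-tPow n a (suc b) = trans (mul-mono 0 1 (tPow n) a (suc b) z≤n (s≤s z≤n)) (mono-shift 0 n a b)

  module Predual (P : PS) where

    sumBox-cong : ∀ a b n {F G : Vec (ℕ × ℕ) n → Carrier} → (∀ v → F v ≈ G v) →
      sumBox P a b n F ≈ sumBox P a b n G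
    sumBox-cong a b zero    h = h []
    sumBox-cong a b (suc n) h = sum2-cong a b (λ i₁ i₂ _ _ → sumBox-cong a b n (λ v → h _))

    sumBox-zero : ∀ a b n {F : Vec (ℕ × ℕ) n → Carrier} → (∀ v → F v ≈ 0#) → sumBox P a b n F ≈ 0#
    sumBox-zero a b zero    h = h []
    sumBox-zero a b (suc n) h = sum2-zero a b (λ i₁ i₂ _ _ → sumBox-zero a b n (λ v → h _))

    sumBox-distribˡ : ∀ a b n x (F : Vec (ℕ × ℕ) n → Carrier) →
      x * sumBox P a b n F ≈ sumBox P a b n (λ v → x * F v)
    sumBox-distribˡ a b zero    x F = refl
    sumBox-distribˡ a b (suc n) x F =
      trans (sum2-distribˡ a b x _) (sum2-cong a b (λ i₁ i₂ _ _ → sumBox-distribˡ a b n x _))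

    sumBox-shrink : ∀ a b {a' b'} n (F : Vec (ℕ × ℕ) n → Carrier) → a' ≤ a → b' ≤ b →
      (∀ v → Any (Outside a' b') v → F v ≈ 0#) → sumBox P a b n F ≈ sumBox P a' b' n F
    sumBox-shrink a b zero    F a'≤a b'≤b h = refl
    sumBox-shrink a b {a'} {b'} (suc n) F a'≤a b'≤b h = begin
      sum2 a b (λ i₁ i₂ → sumBox P a b n (λ v → F ((i₁ , i₂) ∷ v)))
        ≈⟨ sum2-cong a b (λ i₁ i₂ _ _ → sumBox-shrink a b n _ a'≤a b'≤b (λ v out → h _ (there out))) ⟩
      sum2 a b (λ i₁ i₂ → sumBox P a' b' n (λ v → F ((i₁ , i₂) ∷ v)))
        ≈⟨ sum2-shrink a b _ a'≤a b'≤b (λ i₁ i₂ out → sumBox-zero a' b' n (λ v → h _ (here out))) ⟩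
      sum2 a' b' (λ i₁ i₂ → sumBox P a' b' n (λ v → F ((i₁ , i₂) ∷ v))) ∎

    mul-sumBoxʳ : ∀ a' b' n (f : PS) (G : Vec (ℕ × ℕ) n → PS) a b →
      mul f (λ x y → sumBox P a' b' n (λ v → G v x y)) a b ≈ sumBox P a' b' n (λ v → mul f (G v) a b)
    mul-sumBoxʳ a' b' zero    f G a b = refl
    mul-sumBoxʳ a' b' (suc n) f G a b = begin
      mul f (λ x y → sum2 a' b' (λ i₁ i₂ → H i₁ i₂ x y)) a b
        ≈⟨ mul-sumToʳ a' f (λ i₁ x y → sumTo b' (λ i₂ → H i₁ i₂ x y)) a b ⟩
      sumTo a' (λ i₁ → mul f (λ x y → sumTo b' (λ i₂ → H i₁ i₂ x y)) a b)
        ≈⟨ sumTo-cong a' (λ i₁ _ → mul-sumToʳ b' f (H i₁) a b) ⟩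
      sum2 a' b' (λ i₁ i₂ → mul f (H i₁ i₂) a b)
        ≈⟨ sum2-cong a' b' (λ i₁ i₂ _ _ → mul-sumBoxʳ a' b' n f (λ v → G ((i₁ , i₂) ∷ v)) a b) ⟩
      sum2 a' b' (λ i₁ i₂ → sumBox P a' b' n (λ v → mul f (G ((i₁ , i₂) ∷ v)) a b)) ∎
      where
      H : ℕ → ℕ → PS
      H i₁ i₂ x y = sumBox P a' b' n (λ v → G ((i₁ , i₂) ∷ v) x y)

    module Dual (cat : IsCatalan P) (T : Coeffs) (dual : IsDualCoeffs P T) where

      -- t divides P, read off from P = t - z t² P̃.
      P-DivBy : DivBy P 0 1
      P-DivBy x y (inj₁ ())
      P-DivBy x zero (inj₂ (s≤s z≤n)) = begin
        P x 0                                          ≈⟨ proj₂ cat x 0 ⟩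
        tSer x 0 - mul (mono 1 2) (proj₁ cat) x 0
          ≈⟨ +-cong (mono-miss 0 1 x 0 (inj₂ (λ ())))
                    (-‿cong (mul-DivByˡ (proj₁ cat) (mono-DivBy 1 2) x 0 (inj₂ (s≤s z≤n)))) ⟩
        0# - 0#                                        ≈⟨ -‿inverseʳ 0# ⟩
        0#                                             ∎

      prodP-DivBy : ∀ k → DivBy (prodP P k) 0 k
      prodP-DivBy zero    = DivBy-00 (prodP P 0)
      prodP-DivBy (suc k) = PE.subst (DivBy (prodP P (suc k)) 0) (ℕ.+-comm k 1)
                                     (mul-DivBy (prodP-DivBy k) (dil-DivBy k P-DivBy))

      ẽ-DivBy : ∀ i₁ i₂ → DivBy (ẽ P i₁ i₂) i₁ i₂
      ẽ-DivBy i₁ i₂ = PE.subst (λ k → DivBy (ẽ P i₁ i₂) k i₂) (ℕ.+-identityʳ i₁)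
                               (mul-DivBy (mono-DivBy i₁ 0) (prodP-DivBy i₂))

      piBasis-DivBy : ∀ {m} s {v : Vec (ℕ × ℕ) m} {i₁ i₂} → (i₁ , i₂) ∈ v → DivBy (piBasis P s v) i₁ i₂
      piBasis-DivBy s {(i₁ , i₂) ∷ w} (here PE.refl) =
        mul-DivByˡ (piBasis P (s +ℕ i₂) w) (dil-DivBy s (ẽ-DivBy i₁ i₂))
      piBasis-DivBy s {(j₁ , j₂) ∷ w} (there i∈w) =
        mul-DivByʳ (dil s (ẽ P j₁ j₂)) (piBasis-DivBy (s +ℕ j₂) i∈w)

      piBasis-vanish : ∀ {m} s (v : Vec (ℕ × ℕ) m) a b → Any (Outside a b) v → piBasis P s v a b ≈ 0#
      piBasis-vanish s v a b out with find out
      ... | (i₁ , i₂) , i∈v , i-out = piBasis-DivBy s i∈v a b i-out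

      dilated-dual : ∀ s a b x y → x ≤ a → y ≤ b →
        sum2 a b (λ i₁ i₂ → T i₁ i₂ * dil s (ẽ P i₁ i₂) x y) ≈ dil s tSer x y
      dilated-dual s a b x y x≤a y≤b = begin
        sum2 a b (λ i₁ i₂ → T i₁ i₂ * (pow q (s *ℕ x) * ẽ P i₁ i₂ x y))
          ≈⟨ sum2-cong a b (λ _ _ _ _ → x∙yz≈y∙xz _ _ _) ⟩
        sum2 a b (λ i₁ i₂ → pow q (s *ℕ x) * (T i₁ i₂ * ẽ P i₁ i₂ x y))
          ≈⟨ sym (sum2-distribˡ a b _ _) ⟩
        pow q (s *ℕ x) * sum2 a b (λ i₁ i₂ → T i₁ i₂ * ẽ P i₁ i₂ x y)
          ≈⟨ *-cong refl (sum2-shrink a b _ x≤a y≤b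
                (λ i₁ i₂ out → product-zero (inj₂ (ẽ-DivBy i₁ i₂ x y out)))) ⟩
        pow q (s *ℕ x) * expand P T x y
          ≈⟨ *-cong refl (dual x y) ⟩
        dil s tSer x y ∎

      PC : ∀ {n} → Vec (ℕ × ℕ) n → Carrier
      PC v = prodCoeffs P (λ _ → T) v

      -- Π_n(T̂,…,T̂) with the dilations starting at q^s; Πn P n (λ _ → T) is Πfrom n 0.
      Πfrom : ℕ → ℕ → PS
      Πfrom n s a b = sumBox P a b n (λ v → PC v * piBasis P s v a b)

      Πfrom-box : ∀ n s a b x y → x ≤ a → y ≤ b →
        sumBox P a b n (λ v → PC v * piBasis P s v x y) ≈ Πfrom n s x y
      Πfrom-box n s a b x y x≤a y≤b =
        sumBox-shrink a b n _ x≤a y≤b (λ v out → product-zero (inj₂ (piBasis-vanish s v x y out)))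

      peel : ∀ n s' x (f : PS) a b → Πfrom n s' ≋ tPow n →
        sumBox P a b n (λ v → (x * PC v) * mul f (piBasis P s' v) a b) ≈ x * mul f (tPow n) a b
      peel n s' x f a b ih = begin
        sumBox P a b n (λ v → (x * PC v) * mul f (piBasis P s' v) a b)
          ≈⟨ sumBox-cong a b n (λ v → trans (*-assoc _ _ _) (*-cong refl (sym (mul-scalʳ (PC v) f (piBasis P s' v) a b)))) ⟩
        sumBox P a b n (λ v → x * mul f (λ i j → PC v * piBasis P s' v i j) a b)
          ≈⟨ sym (sumBox-distribˡ a b n x (λ v → mul f (λ i j → PC v * piBasis P s' v i j) a b)) ⟩
        x * sumBox P a b n (λ v → mul f (λ i j → PC v * piBasis P s' v i j) a b)
          ≈⟨ *-cong refl (sym (mul-sumBoxʳ a b n f (λ v i j → PC v * piBasis P s' v i j) a b)) ⟩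
        x * mul f (λ i j → sumBox P a b n (λ v → PC v * piBasis P s' v i j)) a b
          ≈⟨ *-cong refl (mul-cong-box {f = f} a b (λ _ _ _ _ → refl)
                (λ i j i≤a j≤b → trans (Πfrom-box n s' a b i j i≤a j≤b) (ih i j))) ⟩
        x * mul f (tPow n) a b ∎

      Πfrom-tPow : ∀ n s → Πfrom n s ≋ tPow n
      Πfrom-tPow zero    s a b = *-identityˡ _
      Πfrom-tPow (suc n) s a b = begin
        Πfrom (suc n) s a b
          ≈⟨ sum2-cong a b (λ i₁ i₂ _ _ → peel n (s +ℕ i₂) (T i₁ i₂) (D i₁ i₂) a b (Πfrom-tPow n _)) ⟩
        sum2 a b (λ i₁ i₂ → T i₁ i₂ * mul (D i₁ i₂) (tPow n) a b)
          ≈⟨ sym (trans (mul-sum2ˡ a b (λ i₁ i₂ x y → T i₁ i₂ * D i₁ i₂ x y) (tPow n) a b)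
                       (sum2-cong a b (λ i₁ i₂ _ _ → mul-scalˡ (T i₁ i₂) (D i₁ i₂) (tPow n) a b))) ⟩
        mul (λ x y → sum2 a b (λ i₁ i₂ → T i₁ i₂ * D i₁ i₂ x y)) (tPow n) a b
          ≈⟨ mul-cong-box {g = tPow n} a b (dilated-dual s a b) (λ _ _ _ _ → refl) ⟩
        mul (dil s tSer) (tPow n) a b
          ≈⟨ mul-cong-box {g = tPow n} a b (λ x y _ _ → dil-mono₀ s 1 x y) (λ _ _ _ _ → refl) ⟩
        mul tSer (tPow n) a b
          ≈⟨ t-mul-tPow n a b ⟩
        tPow (suc n) a b ∎
        where
        D : ℕ → ℕ → PS
        D i₁ i₂ = dil s (ẽ P i₁ i₂)

-- The statement holds for every n, including n = 0.
proposition4p8p2 : {c ℓ : Level} (R : CommutativeRing c ℓ) (q : CommutativeRing.Carrier R)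
    (P : Series.PS R q) → Series.IsCatalan R q P →
    (T : Series.Coeffs R q) → Series.IsDualCoeffs R q P T →
    (n : ℕ) → 1 ≤ n →
    Series._≋_ R q (Series.Πn R q P n (λ _ → T)) (Series.tPow R q n)
proposition4p8p2 R q P cat T dual n _ = Proof.Predual.Dual.Πfrom-tPow R q P cat T dual n 0
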